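{- Let $P,Q$ be parts of a system $S$. The operators $\Diamond^Q_P\Diamond^P_Q$ and $\Box^Q_P\Box^P_Q$ on the set of constraints on $P$ are a pair of adjoint modalities, with $\Diamond^Q_P\Diamond^P_Q$ left adjoint to $\Box^Q_P\Box^P_Q$ (i.e. $\Diamond^Q_P\Diamond^P_Q\phi\vdash\psi$ iff $\phi\vdash\Box^Q_P\Box^P_Q\psi$). Moreover, they are the identity if and only if $P\le Q$.
   Context: A system $S$ is modeled by a set $B_S$ of possible behaviors. A part $P$ of $S$ is a surjective function $|_P\colon B_S\to B_P$; write $s|_P$ for its value. $P\le Q$ means there is a function $g\colon B_Q\to B_P$ with $g(s|_Q)=s|_P$ for all $s\in B_S$. A constraint on $P$ is a predicate $B_P\to\{\mathtt{true},\mathtt{false}\}$; $\phi\vdash\psi$ is pointwise implication. Allowance: $\Diamond^P_Q\phi(q)=\exists s\in B_S.\,(s|_Q=q)\wedge\phi(s|_P)$. Ensurance: $\Box^P_Q\phi(q)=\forall s\in B_S.\,(s|_Q=q)\Rightarrow\phi(s|_P)$. -}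

module Defs where

open import Data.Product using (Σ; ∃; _×_; _,_)
open import Relation.Binary.PropositionalEquality using (_≡_)
open import Function.Bundles using (_⇔_)

-- A system S is given by its type of behaviours B_S (here: the type S itself).
-- A part P of S is a surjective map |_P : B_S → B_P.
record Part (S : Set) : Set₁ where
  field
    B    : Set
    res  : S → B
    surj : ∀ (p : B) → ∃ λ (s : S) → res s ≡ p
open Part public

_≤ₚ_ : {S : Set} → Part S → Part S → Set
_≤ₚ_ {S} P Q = Σ (B Q → B P) λ g → ∀ (s : S) → g (res Q s) ≡ res P s

Constraint : {S : Set} → Part S → Set₁
Constraint P = B P → Set

_⊢_ : {X : Set} → (X → Set) → (X → Set) → Set
_⊢_ {X} φ ψ = ∀ (x : X) → φ x → ψ x

◇ : {S : Set} (P Q : Part S) → Constraint P → Constraint Q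
◇ {S} P Q φ q = Σ S λ s → (res Q s ≡ q) × φ (res P s)

□ : {S : Set} (P Q : Part S) → Constraint P → Constraint Q
□ {S} P Q φ q = ∀ (s : S) → res Q s ≡ q → φ (res P s)

IsIdentity : {S : Set} (P : Part S) → (Constraint P → Constraint P) → Set₁
IsIdentity P F = ∀ (φ : Constraint P) (p : B P) → F φ p ⇔ φ p

-- For any two parts, allowance ◇^P_Q is left adjoint to
--    ensurance □^Q_P (both sides say "φ(s|_P) implies ψ(s|_Q) for every s").
--    Adjunctions compose, so ◇^Q_P ◇^P_Q ⊣ □^Q_P □^P_Q.
--  * Identity.  P ≤ Q is equivalent to "Q determines P": behaviours with the
--    same Q-part have the same P-part (surjectivity of |_Q builds the factor
--    map).  The round trip ◇◇ is always inflationary and □□ always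
--    deflationary (surjectivity of |_P); when Q determines P the reverse
--    entailments hold as well.  Conversely, if □□ fixes the constraint
--    "equals s|_P", then Q determines P.
module Submission where

open import Defs
open import Data.Product using (_×_; _,_; proj₁; proj₂)
open import Function.Base using (_∘_)
open import Function.Bundles using (_⇔_; mk⇔; module Equivalence)
open import Function.Properties.Equivalence using () renaming (trans to ⇔-trans)
open import Relation.Binary.PropositionalEquality using (_≡_; refl; sym; trans; cong; subst)

_⊣_ : {X Y : Set} → ((X → Set) → (Y → Set)) → ((Y → Set) → (X → Set)) → Set₁
_⊣_ {X} {Y} F G = ∀ (φ : X → Set) (ψ : Y → Set) → (F φ ⊢ ψ) ⇔ (φ ⊢ G ψ)

⊣-compose : {X Y Z : Set}
  {F : (X → Set) → (Y → Set)} {G : (Y → Set) → (X → Set)}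
  {F′ : (Y → Set) → (Z → Set)} {G′ : (Z → Set) → (Y → Set)} →
  F ⊣ G → F′ ⊣ G′ → (F′ ∘ F) ⊣ (G ∘ G′)
⊣-compose {F = F} {G′ = G′} F⊣G F′⊣G′ φ ψ = ⇔-trans (F′⊣G′ (F φ) ψ) (F⊣G φ (G′ ψ))

Determines : {S : Set} → Part S → Part S → Set
Determines {S} Q P = ∀ (s t : S) → res Q s ≡ res Q t → res P s ≡ res P t

identity-from : {S : Set} (P : Part S) (F : Constraint P → Constraint P) →
  (∀ φ → φ ⊢ F φ) → (∀ φ → F φ ⊢ φ) → IsIdentity P F
identity-from P F inflate deflate φ p = mk⇔ (deflate φ p) (inflate φ p)

module _ {S : Set} where

  ◇⊣□ : (P Q : Part S) → ◇ P Q ⊣ □ Q P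
  ◇⊣□ P Q φ ψ = mk⇔ to from
    where
    to : ◇ P Q φ ⊢ ψ → φ ⊢ □ Q P ψ
    to h p φp s sP≡p = h (res Q s) (s , refl , subst φ (sym sP≡p) φp)
    from : φ ⊢ □ Q P ψ → ◇ P Q φ ⊢ ψ
    from h q (s , sQ≡q , φsP) = subst ψ sQ≡q (h (res P s) φsP s refl)

  ≤ₚ⇔Determines : (P Q : Part S) → (P ≤ₚ Q) ⇔ Determines Q P
  ≤ₚ⇔Determines P Q = mk⇔ to from
    where
    to : P ≤ₚ Q → Determines Q P
    to (g , factors) s t sQ≡tQ =
      trans (sym (factors s)) (trans (cong g sQ≡tQ) (factors t))
    from : Determines Q P → P ≤ₚ Q
    from det = g , λ s → det (preimage (res Q s)) s (proj₂ (surj Q (res Q s)))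
      where
      preimage : B Q → S
      preimage q = proj₁ (surj Q q)
      g : B Q → B P
      g q = res P (preimage q)

  module _ (P Q : Part S) where

    ◇◇-inflationary : ∀ φ → φ ⊢ ◇ Q P (◇ P Q φ)
    ◇◇-inflationary φ p φp with surj P p
    ... | s , sP≡p = s , sP≡p , s , refl , subst φ (sym sP≡p) φp

    □□-deflationary : ∀ φ → □ Q P (□ P Q φ) ⊢ φ
    □□-deflationary φ p h with surj P p
    ... | s , sP≡p = subst φ sP≡p (h s sP≡p s refl)

    ◇◇-deflationary : Determines Q P → ∀ φ → ◇ Q P (◇ P Q φ) ⊢ φ
    ◇◇-deflationary det φ p (s , sP≡p , t , tQ≡sQ , φtP) =
      subst φ (trans (det t s tQ≡sQ) sP≡p) φtP

    □□-inflationary : Determines Q P → ∀ φ → φ ⊢ □ Q P (□ P Q φ)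
    □□-inflationary det φ p φp s sP≡p t tQ≡sQ =
      subst φ (sym (trans (det t s tQ≡sQ) sP≡p)) φp

    □□-identity⇒Determines : IsIdentity P (λ φ → □ Q P (□ P Q φ)) → Determines Q P
    □□-identity⇒Determines id□□ s t sQ≡tQ =
      sym (Equivalence.from (id□□ (_≡ res P s) (res P s)) refl s refl t (sym sQ≡tQ))

mainTheorem9 : {S : Set} (P Q : Part S) →
    ((φ ψ : Constraint P) → (◇ Q P (◇ P Q φ) ⊢ ψ) ⇔ (φ ⊢ □ Q P (□ P Q ψ)))
    × ((IsIdentity P (λ φ → ◇ Q P (◇ P Q φ)) × IsIdentity P (λ φ → □ Q P (□ P Q φ))) ⇔ (P ≤ₚ Q))
mainTheorem9 P Q = ⊣-compose (◇⊣□ P Q) (◇⊣□ Q P) , mk⇔ identities⇒≤ ≤⇒identities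
  where
  identities⇒≤ : IsIdentity P (λ φ → ◇ Q P (◇ P Q φ)) × IsIdentity P (λ φ → □ Q P (□ P Q φ)) → P ≤ₚ Q
  identities⇒≤ (_ , id□□) = Equivalence.from (≤ₚ⇔Determines P Q) (□□-identity⇒Determines P Q id□□)

  ≤⇒identities : P ≤ₚ Q → IsIdentity P (λ φ → ◇ Q P (◇ P Q φ)) × IsIdentity P (λ φ → □ Q P (□ P Q φ))
  ≤⇒identities P≤Q =
    identity-from P _ (◇◇-inflationary P Q) (◇◇-deflationary P Q det) ,
    identity-from P _ (□□-inflationary P Q det) (□□-deflationary P Q)
    where
    det : Determines Q P
    det = Equivalence.to (≤ₚ⇔Determines P Q) P≤Q
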